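{- Let $\mathcal{T}$ be a $\mathcal{TEL}^{\bigcirc}$-TBox and $\mathcal{A}$ an ABox. Then for every $A,B\in\mathsf{N_C}$, every $a\in\mathsf{N_I}$ and every $n,k\in\mathbb{Z}$: (1) $(\mathcal{T},\mathcal{A})\models A(a,n)$ if and only if $(\mathcal{T},\mathcal{A})\vdash A(a,n)$; and (2) $\mathcal{T}\models A\sqsubseteq \bigcirc^n B$ if and only if $(\mathcal{T},\{A(a,k)\})\vdash B(a,k+n)$.
   Context: Fix pairwise disjoint countably infinite sets $\mathsf{N_I}$ (individual names), $\mathsf{N_C}$ (concept names), $\mathsf{N_R}$ (role names), with $\mathsf{N_R}$ partitioned into rigid role names $\mathsf{N_R^{rig}}$ and local role names $\mathsf{N_R^{loc}}$. A fact is $A(a,n)$ or $r(a,b,n)$ with $a,b\in\mathsf{N_I}$, $A\in\mathsf{N_C}$, $r\in\mathsf{N_R}$, $n\in\mathbb{Z}$; an ABox is a finite set of facts. A $\mathcal{TEL}^{\bigcirc}$-TBox is a finite set of concept inclusions of the forms $A\sqsubseteq\bigcirc^n B$, $A\sqcap A'\sqsubseteq B$, $\exists r.A\sqsubseteq B$, $A\sqsubseteq\exists r.B$ with $A,A',B\in\mathsf{N_C}$, $r\in\mathsf{N_R}$, $n\in\mathbb{Z}$ ($\bigcirc^0B$ is $B$). An interpretation $\mathfrak{J}=(\Delta,(\mathcal{I}_i)_{i\in\mathbb{Z}})$ consists of classical DL interpretations $\mathcal{I}_i$ over a common domain $\Delta\supseteq\mathsf{N_I}$ with $a^{\mathcal{I}_i}=a$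 for $a\in\mathsf{N_I}$, and $r^{\mathcal{I}_i}=r^{\mathcal{I}_0}$ for all $i$ whenever $r\in\mathsf{N_R^{rig}}$. Writing $\cdot^{\mathfrak{J},i}$ for $\cdot^{\mathcal{I}_i}$: $(\bigcirc^nA)^{\mathfrak{J},i}=A^{\mathfrak{J},i+n}$, $(A\sqcap B)^{\mathfrak{J},i}=A^{\mathfrak{J},i}\cap B^{\mathfrak{J},i}$, $(\exists r.A)^{\mathfrak{J},i}=\{d\mid \exists e\in A^{\mathfrak{J},i},(d,e)\in r^{\mathfrak{J},i}\}$. $\mathfrak{J}$ satisfies $A(a,n)$ iff $a\in A^{\mathfrak{J},n}$, $r(a,b,n)$ iff $(a,b)\in r^{\mathfrak{J},n}$, and $C\sqsubseteq D$ iff $C^{\mathfrak{J},i}\subseteq D^{\mathfrak{J},i}$ for all $i\in\mathbb{Z}$. $\mathcal{T}\models\alpha$ and $(\mathcal{T},\mathcal{A})\models\alpha$ denote entailment (truth in all models of $\mathcal{T}$, resp. of $\mathcal{T}\cup\mathcal{A}$). Derivations: let $\mathsf{N_N}$ be a countably infinite set of named nulls disjoint from $\mathsf{N_I}$. $(\mathcal{T},\mathcal{A})\vdash A(a,n)$ means there is a sequence $\mathcal{F}_0,\dots,\mathcal{F}_m$ of sets of formulas with $\mathcal{F}_0=\mathcal{A}\cup\mathcal{T}$, $A(a,n)\in\mathcal{F}_m$, and each $\mathcal{F}_i$ obtained from $\mathcal{F}_{i-1}$ by choosing one of the following rules whose premises are all in $\mathcal{F}_{i-1}$ and adding its conclusions: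 (i) from $r(a,b,n)$ with $r\in\mathsf{N_R^{rig}}$ derive $r(a,b,k)$ for any $k\in\mathbb{Z}$; (ii) from $A(a,n)$ and $A\sqsubseteq\bigcirc^kB$ derive $B(a,n+k)$; (iii) from $A(a,n)$, $A'(a,n)$, $A\sqcap A'\sqsubseteq B$ derive $B(a,n)$; (iv) from $r(a,b,n)$, $A(b,n)$, $\exists r.A\sqsubseteq B$ derive $B(a,n)$; (v) from $A(a,n)$ and $A\sqsubseteq\exists r.B$ derive $r(a,b,n)$ and $B(b,n)$ for a fresh $b\in\mathsf{N_N}$. -}

module Defs where

open import Data.Nat using (ℕ)
open import Data.Integer using (ℤ; _+_; 0ℤ)
open import Data.Bool using (Bool; true; false)
open import Data.List using (List; _∷_; [])
open import Data.List.Membership.Propositional using (_∈_)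
open import Data.Product using (Σ; _×_; _,_; ∃)
open import Function.Bundles using (_⇔_)
open import Function.Definitions using (Injective)
open import Relation.Binary.PropositionalEquality using (_≡_)
open import Relation.Binary.Construct.Closure.ReflexiveTransitive using (Star)
open import Level using (Level; suc; zero)

-- The partition of N_R into
-- rigid / local role names is given by an arbitrary predicate
-- rig : RoleName → Bool (rig r ≡ true  iff  r ∈ N_R^rig).

IndName : Set
IndName = ℕ

ConceptName : Set
ConceptName = ℕ

RoleName : Set
RoleName = ℕ

Rigidity : Set
Rigidity = RoleName → Bool

data Fact : Set where
  conceptFact : ConceptName → IndName → ℤ → Fact
  roleFact    : RoleName → IndName → IndName → ℤ → Fact

ABox : Set
ABox = List Fact

data CI : Set where
  _⊑○[_]_  : ConceptName → ℤ → ConceptName → CI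
  _⊓_⊑_    : ConceptName → ConceptName → ConceptName → CI
  ∃[_]_⊑_  : RoleName → ConceptName → ConceptName → CI
  _⊑∃[_]_  : ConceptName → RoleName → ConceptName → CI

TBox : Set
TBox = List CI

-- Temporal interpretations 𝔍 = (Δ, (I_i)_{i∈ℤ}).
-- Δ ⊇ N_I with a^{I_i} = a is modelled by an injective embedding ind.
-- Concept / role extensions are (proof-relevant) predicates on Δ.

record Interp : Set₁ where
  field
    Δ    : Set
    ind  : IndName → Δ
    ind-injective : Injective _≡_ _≡_ ind
    conc : ConceptName → ℤ → Δ → Set
    role : RoleName → ℤ → Δ → Δ → Set

open Interp public

RespectsRigidity : Rigidity → Interp → Set
RespectsRigidity rig 𝔍 =
  ∀ r → rig r ≡ true → ∀ i d e → role 𝔍 r i d e ⇔ role 𝔍 r 0ℤ d e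

SatCI : Interp → CI → Set
SatCI 𝔍 (A ⊑○[ n ] B) = ∀ i d → conc 𝔍 A i d → conc 𝔍 B (i + n) d
SatCI 𝔍 (A ⊓ A' ⊑ B)  = ∀ i d → conc 𝔍 A i d → conc 𝔍 A' i d → conc 𝔍 B i d
SatCI 𝔍 (∃[ r ] A ⊑ B) = ∀ i d e → role 𝔍 r i d e → conc 𝔍 A i e → conc 𝔍 B i d
SatCI 𝔍 (A ⊑∃[ r ] B) = ∀ i d → conc 𝔍 A i d → Σ (Δ 𝔍) λ e → role 𝔍 r i d e × conc 𝔍 B i e

SatFact : Interp → Fact → Set
SatFact 𝔍 (conceptFact A a n) = conc 𝔍 A n (ind 𝔍 a)
SatFact 𝔍 (roleFact r a b n)  = role 𝔍 r n (ind 𝔍 a) (ind 𝔍 b)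

ModelT : Rigidity → TBox → Interp → Set
ModelT rig 𝒯 𝔍 = RespectsRigidity rig 𝔍 × (∀ {α} → α ∈ 𝒯 → SatCI 𝔍 α)

ModelTA : Rigidity → TBox → ABox → Interp → Set
ModelTA rig 𝒯 𝒜 𝔍 = ModelT rig 𝒯 𝔍 × (∀ {f} → f ∈ 𝒜 → SatFact 𝔍 f)

_⊨ᶠ_ : (Rigidity × TBox × ABox) → Fact → Set₁
(rig , 𝒯 , 𝒜) ⊨ᶠ f = (𝔍 : Interp) → ModelTA rig 𝒯 𝒜 𝔍 → SatFact 𝔍 f

_⊨ᶜ_ : (Rigidity × TBox) → CI → Set₁
(rig , 𝒯) ⊨ᶜ α = (𝔍 : Interp) → ModelT rig 𝒯 𝔍 → SatCI 𝔍 α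

data Term : Set where
  indT  : IndName → Term
  nullT : ℕ → Term

data TFact : Set where
  cF : ConceptName → Term → ℤ → TFact
  rF : RoleName → Term → Term → ℤ → TFact

embedFact : Fact → TFact
embedFact (conceptFact A a n) = cF A (indT a) n
embedFact (roleFact r a b n)  = rF r (indT a) (indT b) n

embedABox : ABox → List TFact
embedABox [] = []
embedABox (f ∷ 𝒜) = embedFact f ∷ embedABox 𝒜

data OccursIn (t : Term) : TFact → Set where
  occ-c  : ∀ {A n} → OccursIn t (cF A t n)
  occ-r₁ : ∀ {r u n} → OccursIn t (rF r t u n)
  occ-r₂ : ∀ {r u n} → OccursIn t (rF r u t n)

Fresh : ℕ → List TFact → Set
Fresh b F = ∀ {f} → f ∈ F → OccursIn (nullT b) f → Data.Empty.⊥
  where import Data.Empty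

-- One derivation step ℱ_{i-1} ⇒ ℱ_i.  The TBox part of ℱ_i never changes,
-- so we keep it as the parameter 𝒯 and store only the facts in the state.
data Step (rig : Rigidity) (𝒯 : TBox) : List TFact → List TFact → Set where
  rule-i   : ∀ {F r a b n} k → rig r ≡ true → rF r a b n ∈ F →
             Step rig 𝒯 F (rF r a b k ∷ F)
  rule-ii  : ∀ {F A B a n k} → cF A a n ∈ F → (A ⊑○[ k ] B) ∈ 𝒯 →
             Step rig 𝒯 F (cF B a (n + k) ∷ F)
  rule-iii : ∀ {F A A' B a n} → cF A a n ∈ F → cF A' a n ∈ F → (A ⊓ A' ⊑ B) ∈ 𝒯 →
             Step rig 𝒯 F (cF B a n ∷ F)
  rule-iv  : ∀ {F r A B a b n} → rF r a b n ∈ F → cF A b n ∈ F → (∃[ r ] A ⊑ B) ∈ 𝒯 →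
             Step rig 𝒯 F (cF B a n ∷ F)
  rule-v   : ∀ {F A r B a n} b → cF A a n ∈ F → (A ⊑∃[ r ] B) ∈ 𝒯 → Fresh b F →
             Step rig 𝒯 F (rF r a (nullT b) n ∷ cF B (nullT b) n ∷ F)

Derives : Rigidity → TBox → ABox → ConceptName → IndName → ℤ → Set
Derives rig 𝒯 𝒜 A a n =
  ∃ λ F → Star (Step rig 𝒯) (embedABox 𝒜) F × cF A (indT a) n ∈ F

-- Soundness: every rule application is valid in every model, where a fresh null can be
-- interpreted by the witness that the model provides for the applied ∃-axiom.
-- Completeness: the derivation states themselves form a model.  Its points are terms
-- paired with a state in which they occur; A holds at time i of (F , t) iff A(t,i) is
-- derivable from F.  Two derivations from the same state can be merged, since nulls
-- are only ever introduced fresh and can therefore be renamed apart; this is what makes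
-- the conjunction and ∃-on-the-left axioms hold.  Part (2) is part (1) for the
-- one-fact ABox {A(a,k)}, read at an arbitrary time point of an arbitrary model.
module Submission where

open import Defs
open import Data.Integer using (ℤ; _+_)
open import Data.List using (_∷_; [])
open import Data.Product using (_×_; _,_)
open import Function.Bundles using (_⇔_)

open import Data.Integer using (_-_; 0ℤ)
import Data.Integer.Properties as ℤₚ
open import Data.Integer.Tactic.RingSolver using (solve-∀)
open import Data.List using (List)
open import Data.List.Membership.Propositional using (_∈_)
open import Data.List.Relation.Unary.All as All using (All; _∷_; [])
open import Data.List.Relation.Unary.Any using (here; there)
open import Data.Nat using (ℕ; suc; _⊔_; _≤_; _≟_)
import Data.Nat.Properties as ℕₚ
open import Data.Product using (∃; ∃₂; proj₁; proj₂)
open import Data.Unit using (⊤; tt)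
open import Function.Base using (id; _∘_; const)
open import Function.Bundles using (mk⇔; Equivalence)
open import Relation.Binary.Construct.Closure.ReflexiveTransitive using (Star; ε; _◅_; _◅◅_)
open import Relation.Binary.PropositionalEquality
open import Relation.Nullary using (yes; no; contradiction)

update : {X : Set} → (ℕ → X) → ℕ → X → ℕ → X
update ν b x c with c ≟ b
... | yes _ = x
... | no  _ = ν c

update-≡ : {X : Set} (ν : ℕ → X) (b : ℕ) (x : X) → update ν b x b ≡ x
update-≡ ν b x with b ≟ b
... | yes _  = refl
... | no b≢b = contradiction refl b≢b

update-≢ : {X : Set} (ν : ℕ → X) {b c : ℕ} {x : X} → c ≢ b → update ν b x c ≡ ν c
update-≢ ν {b} {c} c≢b with c ≟ b
... | yes c≡b = contradiction c≡b c≢b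
... | no  _   = refl

value : {X : Set} → (IndName → X) → (ℕ → X) → Term → X
value ι ν (indT a)  = ι a
value ι ν (nullT c) = ν c

value-cong : {X : Set} (ι : IndName → X) {ν ν' : ℕ → X} (t : Term) →
             (∀ {c} → t ≡ nullT c → ν c ≡ ν' c) → value ι ν t ≡ value ι ν' t
value-cong ι (indT a)  _ = refl
value-cong ι (nullT c) h = h refl

AgreeOn : {X : Set} → TFact → (ℕ → X) → (ℕ → X) → Set
AgreeOn f ν ν' = ∀ c → OccursIn (nullT c) f → ν c ≡ ν' c

NullIn : ℕ → List TFact → Set
NullIn c F = ∃ λ f → f ∈ F × OccursIn (nullT c) f

Rooted : List TFact → Term → Set
Rooted F (indT _)  = ⊤
Rooted F (nullT c) = NullIn c F

update-agrees : {X : Set} {ν : ℕ → X} {b : ℕ} {x : X} {f : TFact} {F : List TFact} →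
                Fresh b F → f ∈ F → AgreeOn f (update ν b x) ν
update-agrees {ν = ν} fresh f∈F c o = update-≢ ν λ { refl → fresh f∈F o }

termBound : Term → ℕ
termBound (indT _)  = 0
termBound (nullT c) = c

factBound : TFact → ℕ
factBound (cF _ t _)   = termBound t
factBound (rF _ t u _) = termBound t ⊔ termBound u

nullBound : List TFact → ℕ
nullBound []      = 0
nullBound (f ∷ F) = factBound f ⊔ nullBound F

occurs-≤ : ∀ {b f} → OccursIn (nullT b) f → b ≤ factBound f
occurs-≤         occ-c             = ℕₚ.≤-refl
occurs-≤ {b}     (occ-r₁ {u = u}) = ℕₚ.m≤m⊔n b (termBound u)
occurs-≤ {b}     (occ-r₂ {u = u}) = ℕₚ.m≤n⊔m (termBound u) b

occurs-≤-nullBound : ∀ {b f F} → f ∈ F → OccursIn (nullT b) f → b ≤ nullBound F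
occurs-≤-nullBound {F = g ∷ F} (here refl) o =
  ℕₚ.≤-trans (occurs-≤ o) (ℕₚ.m≤m⊔n (factBound g) (nullBound F))
occurs-≤-nullBound {F = g ∷ F} (there f∈F) o =
  ℕₚ.≤-trans (occurs-≤-nullBound f∈F o) (ℕₚ.m≤n⊔m (factBound g) (nullBound F))

freshNull : List TFact → ℕ
freshNull F = suc (nullBound F)

freshNull-fresh : ∀ F → Fresh (freshNull F) F
freshNull-fresh F f∈F o = ℕₚ.1+n≰n (occurs-≤-nullBound f∈F o)

renameTerm : (ℕ → ℕ) → Term → Term
renameTerm σ = value indT (nullT ∘ σ)

rename : (ℕ → ℕ) → TFact → TFact
rename σ (cF A t n)   = cF A (renameTerm σ t) n
rename σ (rF r t u n) = rF r (renameTerm σ t) (renameTerm σ u) n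

renameTerm-cong : ∀ {σ σ'} t → (∀ {c} → t ≡ nullT c → σ c ≡ σ' c) →
                  renameTerm σ t ≡ renameTerm σ' t
renameTerm-cong t h = value-cong indT t (cong nullT ∘ h)

rename-cong : ∀ f {σ σ'} → AgreeOn f σ σ' → rename σ f ≡ rename σ' f
rename-cong (cF A t n) h =
  cong (λ x → cF A x n) (renameTerm-cong t λ { refl → h _ occ-c })
rename-cong (rF r t u n) h = cong₂ (λ x y → rF r x y n)
  (renameTerm-cong t λ { refl → h _ occ-r₁ })
  (renameTerm-cong u λ { refl → h _ occ-r₂ })

renameTerm-fixes : ∀ {σ F} t → Rooted F t → (∀ c → NullIn c F → σ c ≡ c) →
                   renameTerm σ t ≡ t
renameTerm-fixes (indT a)  _ _   = refl
renameTerm-fixes (nullT c) r fix = cong nullT (fix c r)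

rename-id : ∀ f → rename id f ≡ f
rename-id (cF A (indT _) n)            = refl
rename-id (cF A (nullT _) n)           = refl
rename-id (rF r (indT _) (indT _) n)   = refl
rename-id (rF r (indT _) (nullT _) n)  = refl
rename-id (rF r (nullT _) (indT _) n)  = refl
rename-id (rF r (nullT _) (nullT _) n) = refl

module Derivation (rig : Rigidity) (𝒯 : TBox) where

  infix 4 _⇒*_ _⊢_

  _⇒*_ : List TFact → List TFact → Set
  _⇒*_ = Star (Step rig 𝒯)

  _⊢_ : List TFact → TFact → Set
  F ⊢ f = ∃ λ G → F ⇒* G × f ∈ G

  ⊢-by : ∀ {F G f} → F ⇒* G → Step rig 𝒯 G (f ∷ G) → F ⊢ f
  ⊢-by F⇒G step = _ , F⇒G ◅◅ (step ◅ ε) , here refl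

  Step-⊆ : ∀ {X Y f} → Step rig 𝒯 X Y → f ∈ X → f ∈ Y
  Step-⊆ (rule-i _ _ _)     = there
  Step-⊆ (rule-ii _ _)      = there
  Step-⊆ (rule-iii _ _ _)   = there
  Step-⊆ (rule-iv _ _ _)    = there
  Step-⊆ (rule-v _ _ _ _)   = there ∘ there

  ⇒*-⊆ : ∀ {X Y f} → X ⇒* Y → f ∈ X → f ∈ Y
  ⇒*-⊆ ε          = id
  ⇒*-⊆ (step ◅ D) = ⇒*-⊆ D ∘ Step-⊆ step

  _⊆[_]_ : List TFact → (ℕ → ℕ) → List TFact → Set
  X ⊆[ σ ] H = ∀ {f} → f ∈ X → rename σ f ∈ H

  Replay : (ℕ → ℕ) → List TFact → List TFact → List TFact → Set
  Replay σ X Y H =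
    ∃₂ λ H' σ' → H ⇒* H' × Y ⊆[ σ' ] H' × (∀ c → NullIn c X → σ' c ≡ σ c)

  ∷-⊆[] : ∀ {σ X H x y} → rename σ x ≡ y → X ⊆[ σ ] H → (x ∷ X) ⊆[ σ ] (y ∷ H)
  ∷-⊆[] eq X⊆H (here refl) = here eq
  ∷-⊆[] eq X⊆H (there p)   = there (X⊆H p)

  Step-replay : ∀ {σ X Y H} → Step rig 𝒯 X Y → X ⊆[ σ ] H → Replay σ X Y H
  Step-replay (rule-i k rigid p) m = _ , _ , rule-i k rigid (m p) ◅ ε , ∷-⊆[] refl m , λ _ _ → refl
  Step-replay (rule-ii p t)      m = _ , _ , rule-ii (m p) t ◅ ε , ∷-⊆[] refl m , λ _ _ → refl
  Step-replay (rule-iii p q t)   m = _ , _ , rule-iii (m p) (m q) t ◅ ε , ∷-⊆[] refl m , λ _ _ → refl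
  Step-replay (rule-iv p q t)    m = _ , _ , rule-iv (m p) (m q) t ◅ ε , ∷-⊆[] refl m , λ _ _ → refl
  Step-replay {σ} {X} {H = H} (rule-v {r = r} {B} {a} {n} b p t fresh) m =
    _ , σ' , rule-v b' (m p) t (freshNull-fresh H) ◅ ε , m' , fixes
    where
    b' = freshNull H
    σ' = update σ b b'
    fixes : ∀ c → NullIn c X → σ' c ≡ σ c
    fixes c (f , f∈X , o) = update-agrees fresh f∈X c o
    m' : (rF r a (nullT b) n ∷ cF B (nullT b) n ∷ X) ⊆[ σ' ]
         (rF r (renameTerm σ a) (nullT b') n ∷ cF B (nullT b') n ∷ H)
    m' (here refl) = here (cong₂ (λ x y → rF r x (nullT y) n)
      (renameTerm-cong a λ { refl → fixes _ (_ , p , occ-c) }) (update-≡ σ b b'))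
    m' (there (here refl)) = there (here (cong (λ y → cF B (nullT y) n) (update-≡ σ b b')))
    m' (there (there q))   =
      there (there (subst (_∈ H) (sym (rename-cong _ (update-agrees fresh q))) (m q)))

  ⇒*-replay : ∀ {σ X Y H} → X ⇒* Y → X ⊆[ σ ] H → Replay σ X Y H
  ⇒*-replay ε m = _ , _ , ε , m , λ _ _ → refl
  ⇒*-replay (step ◅ D) m with Step-replay step m
  ... | _ , _ , D₁ , m₁ , fix₁ with ⇒*-replay D m₁
  ... | _ , _ , D₂ , m₂ , fix₂ = _ , _ , D₁ ◅◅ D₂ , m₂ ,
    λ c (f , f∈X , o) → trans (fix₂ c (f , Step-⊆ step f∈X , o)) (fix₁ c (f , f∈X , o))

  ⇒*-join : ∀ {F G Y} → F ⇒* G → F ⇒* Y → Replay id F Y G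
  ⇒*-join F⇒G F⇒Y = ⇒*-replay F⇒Y λ p → subst (_∈ _) (sym (rename-id _)) (⇒*-⊆ F⇒G p)

  ⊢-together : ∀ {F f A t i} → Rooted F t → F ⊢ f → F ⊢ cF A t i →
               ∃ λ H → F ⇒* H × f ∈ H × cF A t i ∈ H
  ⊢-together {t = t} rooted (G , F⇒G , f∈G) (_ , F⇒Y , q) with ⇒*-join F⇒G F⇒Y
  ... | H , σ , G⇒H , m , fix = H , F⇒G ◅◅ G⇒H , ⇒*-⊆ G⇒H f∈G ,
    subst (λ x → cF _ x _ ∈ H) (renameTerm-fixes t rooted fix) (m q)

module Canonical (rig : Rigidity) (𝒯 : TBox) (F₀ : List TFact) where
  open Derivation rig 𝒯

  record Point : Set where
    constructor point
    field
      state  : List TFact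
      term   : Term
      rooted : Rooted state term
  open Point

  -- A role edge must also advance the state, so that facts derived at the target can be
  -- carried back to the source (needed for ∃r.A ⊑ B).
  model : Interp
  model = record
    { Δ             = Point
    ; ind           = λ a → point F₀ (indT a) tt
    ; ind-injective = λ { refl → refl }
    ; conc          = λ A i d → state d ⊢ cF A (term d) i
    ; role          = λ r i d e → state d ⇒* state e × state e ⊢ rF r (term d) (term e) i
    }

  respects-rigidity : RespectsRigidity rig model
  respects-rigidity r rigid i d e = mk⇔ (retime 0ℤ) (retime i)
    where
    retime : ∀ {j} k → role model r j d e → role model r k d e
    retime k (d⇒e , _ , e⇒G , p) = d⇒e , ⊢-by e⇒G (rule-i k rigid p)

  satisfies : ∀ {α} → α ∈ 𝒯 → SatCI model α
  satisfies {A ⊑○[ k ] B} t i d (_ , d⇒G , p) = ⊢-by d⇒G (rule-ii p t)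
  satisfies {A ⊓ A' ⊑ B} t i d x y with ⊢-together (rooted d) x y
  ... | _ , d⇒H , p , q = ⊢-by d⇒H (rule-iii p q t)
  satisfies {∃[ r ] A ⊑ B} t i d e (d⇒e , er) y with ⊢-together (rooted e) er y
  ... | _ , e⇒H , p , q = ⊢-by (d⇒e ◅◅ e⇒H) (rule-iv p q t)
  satisfies {A ⊑∃[ r ] B} t i d (G , d⇒G , p) =
    point G' (nullT b) (_ , here refl , occ-r₂) , (d⇒G' , _ , ε , here refl) , (_ , ε , there (here refl))
    where
    b   = freshNull G
    G'  = rF r (term d) (nullT b) i ∷ cF B (nullT b) i ∷ G
    d⇒G' = d⇒G ◅◅ (rule-v b p t (freshNull-fresh G) ◅ ε)

  isModel : ModelT rig 𝒯 model
  isModel = respects-rigidity , satisfies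

∈-embedABox⁺ : ∀ {g 𝒜} → g ∈ 𝒜 → embedFact g ∈ embedABox 𝒜
∈-embedABox⁺ (here refl) = here refl
∈-embedABox⁺ (there p)   = there (∈-embedABox⁺ p)

canonical-model : ∀ rig 𝒯 𝒜 → ModelTA rig 𝒯 𝒜 (Canonical.model rig 𝒯 (embedABox 𝒜))
canonical-model rig 𝒯 𝒜 = Canonical.isModel rig 𝒯 (embedABox 𝒜) , satisfies-ABox
  where
  satisfies-ABox : ∀ {g} → g ∈ 𝒜 → SatFact (Canonical.model rig 𝒯 (embedABox 𝒜)) g
  satisfies-ABox {conceptFact A a n} p = _ , ε , ∈-embedABox⁺ p
  satisfies-ABox {roleFact r a b n}  p = ε , _ , ε , ∈-embedABox⁺ p

-- The interpretation ι of individuals and the time shift s are parameters so that part (2)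
-- can place the ABox {A(a,k)} at any point of a model.
module Soundness (rig : Rigidity) (𝒯 : TBox) (𝔍 : Interp) (M : ModelT rig 𝒯 𝔍)
                 (ι : IndName → Δ 𝔍) (s : ℤ) where
  open Derivation rig 𝒯

  Holds : (ℕ → Δ 𝔍) → TFact → Set
  Holds ν (cF A t m)   = conc 𝔍 A (s + m) (value ι ν t)
  Holds ν (rF r t u m) = role 𝔍 r (s + m) (value ι ν t) (value ι ν u)

  Holds-cong : ∀ f {ν ν'} → AgreeOn f ν ν' → Holds ν f → Holds ν' f
  Holds-cong (cF A t m) h = subst (conc 𝔍 A (s + m))
    (value-cong ι t λ { refl → h _ occ-c })
  Holds-cong (rF r t u m) h = subst₂ (role 𝔍 r (s + m))
    (value-cong ι t λ { refl → h _ occ-r₁ })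
    (value-cong ι u λ { refl → h _ occ-r₂ })

  Step-sound : ∀ {X Y ν} → Step rig 𝒯 X Y → All (Holds ν) X → ∃ λ ν' → All (Holds ν') Y
  Step-sound {ν = ν} (rule-i {n = n} k rigid p) h = ν , retime (All.lookup h p) ∷ h
    where
    rigidity = proj₁ M _ rigid
    retime : ∀ {d e} → role 𝔍 _ (s + n) d e → role 𝔍 _ (s + k) d e
    retime = Equivalence.from (rigidity (s + k) _ _) ∘ Equivalence.to (rigidity (s + n) _ _)
  Step-sound {ν = ν} (rule-ii {B = B} {a = a} {n} {k} p t) h =
    ν , subst (λ i → conc 𝔍 B i (value ι ν a)) (ℤₚ.+-assoc s n k)
              (proj₂ M t (s + n) _ (All.lookup h p)) ∷ h
  Step-sound {ν = ν} (rule-iii p q t) h = ν , proj₂ M t _ _ (All.lookup h p) (All.lookup h q) ∷ h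
  Step-sound {ν = ν} (rule-iv p q t)  h = ν , proj₂ M t _ _ _ (All.lookup h p) (All.lookup h q) ∷ h
  Step-sound {X} {ν = ν} (rule-v {r = r} {B} {a} {n} b p t fresh) h
    with proj₂ M t (s + n) _ (All.lookup h p)
  ... | e , re , be = ν' , r-edge ∷ b-holds ∷ All.tabulate old
    where
    ν' = update ν b e
    old : ∀ {f} → f ∈ X → Holds ν' f
    old q = Holds-cong _ (λ c o → sym (update-agrees fresh q c o)) (All.lookup h q)
    r-edge : role 𝔍 r (s + n) (value ι ν' a) (ν' b)
    r-edge = subst₂ (role 𝔍 r (s + n))
      (value-cong ι a λ { refl → sym (update-agrees fresh p _ occ-c) })
      (sym (update-≡ ν b e)) re
    b-holds : conc 𝔍 B (s + n) (ν' b)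
    b-holds = subst (conc 𝔍 B (s + n)) (sym (update-≡ ν b e)) be

  ⇒*-sound : ∀ {X Y ν} → X ⇒* Y → All (Holds ν) X → ∃ λ ν' → All (Holds ν') Y
  ⇒*-sound ε          h = _ , h
  ⇒*-sound (step ◅ D) h with Step-sound step h
  ... | _ , h₁ = ⇒*-sound D h₁

  ⊢-sound : ∀ {F f ν} → F ⊢ f → All (Holds ν) F → ∃ λ ν' → Holds ν' f
  ⊢-sound (_ , D , f∈G) h with ⇒*-sound D h
  ... | ν' , h' = ν' , All.lookup h' f∈G

derivation-complete : ∀ rig 𝒯 𝒜 A a n →
  (rig , 𝒯 , 𝒜) ⊨ᶠ conceptFact A a n → Derives rig 𝒯 𝒜 A a n
derivation-complete rig 𝒯 𝒜 A a n entails = entails _ (canonical-model rig 𝒯 𝒜)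

derivation-sound : ∀ rig 𝒯 𝒜 A a n →
  Derives rig 𝒯 𝒜 A a n → (rig , 𝒯 , 𝒜) ⊨ᶠ conceptFact A a n
derivation-sound rig 𝒯 𝒜 A a n D 𝔍 (M , sat-𝒜) =
  subst (λ i → conc 𝔍 A i (ind 𝔍 a)) (ℤₚ.+-identityˡ n)
        (proj₂ (⊢-sound {ν = const (ind 𝔍 0)} D (holds-𝒜 sat-𝒜)))
  where
  open Soundness rig 𝒯 𝔍 M (ind 𝔍) 0ℤ
  holds-embedFact : ∀ {g ν} → SatFact 𝔍 g → Holds ν (embedFact g)
  holds-embedFact {conceptFact A b m} = subst (λ i → conc 𝔍 A i (ind 𝔍 b)) (sym (ℤₚ.+-identityˡ m))
  holds-embedFact {roleFact r b c m}  =
    subst (λ i → role 𝔍 r i (ind 𝔍 b) (ind 𝔍 c)) (sym (ℤₚ.+-identityˡ m))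
  holds-𝒜 : ∀ {𝒜 ν} → (∀ {g} → g ∈ 𝒜 → SatFact 𝔍 g) → All (Holds ν) (embedABox 𝒜)
  holds-𝒜 {[]}    sat = []
  holds-𝒜 {g ∷ 𝒜} sat = holds-embedFact {g} (sat (here refl)) ∷ holds-𝒜 (sat ∘ there)

subsumption-complete : ∀ rig 𝒯 A B a n k →
  (rig , 𝒯) ⊨ᶜ (A ⊑○[ n ] B) → Derives rig 𝒯 (conceptFact A a k ∷ []) B a (k + n)
subsumption-complete rig 𝒯 A B a n k entails =
  entails _ (Canonical.isModel rig 𝒯 F₀) k (Canonical.point F₀ (indT a) tt) (_ , ε , here refl)
  where F₀ = cF A (indT a) k ∷ []

subsumption-sound : ∀ rig 𝒯 A B a n k →
  Derives rig 𝒯 (conceptFact A a k ∷ []) B a (k + n) → (rig , 𝒯) ⊨ᶜ (A ⊑○[ n ] B)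
subsumption-sound rig 𝒯 A B a n k D 𝔍 M i d d∈A =
  subst (λ j → conc 𝔍 B j d) (shift-+ i k n) (proj₂ (⊢-sound {ν = const d} D (d∈A' ∷ [])))
  where
  -- Mapping every individual to d is harmless: the only individual in the ABox is a.
  open Soundness rig 𝒯 𝔍 M (const d) (i - k)
  shift-+ : ∀ i k n → (i - k) + (k + n) ≡ i + n
  shift-+ = solve-∀
  shift : ∀ i k → (i - k) + k ≡ i
  shift = solve-∀
  d∈A' : conc 𝔍 A ((i - k) + k) d
  d∈A' = subst (λ j → conc 𝔍 A j d) (sym (shift i k)) d∈A

proposition1 : (rig : Rigidity) (𝒯 : TBox) (𝒜 : ABox)
    (A B : ConceptName) (a : IndName) (n k : ℤ) →
    (((rig , 𝒯 , 𝒜) ⊨ᶠ conceptFact A a n) ⇔ Derives rig 𝒯 𝒜 A a n)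
    × (((rig , 𝒯) ⊨ᶜ (A ⊑○[ n ] B)) ⇔ Derives rig 𝒯 (conceptFact A a k ∷ []) B a (k + n))
proposition1 rig 𝒯 𝒜 A B a n k =
  mk⇔ (derivation-complete rig 𝒯 𝒜 A a n) (derivation-sound rig 𝒯 𝒜 A a n) ,
  mk⇔ (subsumption-complete rig 𝒯 A B a n k) (subsumption-sound rig 𝒯 A B a n k)
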